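{- Let $\mathbf{T^W}$ be $\mathbf{K^W}$ extended with the axiom schema $\neg W\phi$ (for all formulas $\phi$). Then $\mathbf{T^W}$ is sound and strongly complete with respect to the class of reflexive frames.
   Context: Fix a nonempty set $\mathbf{P}$ of propositional variables. The language $\mathcal{L}(W)$ is given by $\phi::=p\mid\neg\phi\mid(\phi\land\phi)\mid W\phi$ with $p\in\mathbf{P}$; other connectives as usual. A frame is $(S,R)$ with $S\neq\emptyset$, $R\subseteq S\times S$; a model $(S,R,V)$ adds $V:\mathbf{P}\to 2^S$. Truth: Boolean clauses as usual; $\mathcal{M},s\vDash W\phi$ iff $\mathcal{M},s\nvDash\phi$ and $\mathcal{M},t\vDash\phi$ for all $t$ with $sRt$. The system $\mathbf{K^W}$ has: A0 all propositional tautologies; A1 $W\phi\to\neg\phi$; A2 $W\phi\land W\psi\to W(\phi\land\psi)$; MP; R1 from $\phi\to\psi$ infer $W\phi\land\neg\psi\to W\psi$. A set $\Gamma$ is consistent if there are no $\gamma_1,\dots,\gamma_n\in\Gamma$ with $\vdash\neg(\gamma_1\land\dots\land\gamma_n)$. Sound and strongly complete w.r.t. a frame class $C$: every theorem is true at every state of every model based on a frame in $C$, and every consistent set is simultaneously satisfiable at a state of a model based on a frame in $C$. -}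

module Defs where

open import Level using (Level; 0ℓ; _⊔_; Setω) renaming (suc to lsuc)
open import Data.Bool using (Bool; true; false; not; _∧_)
open import Data.Empty using (⊥)
open import Data.Product using (Σ; _×_; _,_)
open import Data.Sum using (_⊎_)
open import Data.List using (List; []; _∷_)
open import Data.List.Relation.Unary.All using (All)
open import Relation.Nullary using (¬_)
open import Relation.Unary using (Pred; _∈_)
open import Relation.Binary.PropositionalEquality using (_≡_)

Zorn : (ℓ : Level) → Set (lsuc ℓ)
Zorn ℓ = (A : Set ℓ) (_≤_ : A → A → Set ℓ) →
         (∀ x → x ≤ x) →
         (∀ x y z → x ≤ y → y ≤ z → x ≤ z) →
         ((C : A → Set ℓ) → (∀ x y → C x → C y → (x ≤ y) ⊎ (y ≤ x)) →
           Σ A (λ u → ∀ x → C x → x ≤ u)) →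
         Σ A (λ m → ∀ x → m ≤ x → x ≤ m)

module Logic (P : Set) where

  infixr 6 _∧'_
  infixr 5 _⇒_

  data Form : Set where
    var  : P → Form
    ¬'_  : Form → Form
    _∧'_ : Form → Form → Form
    W    : Form → Form

  _⇒_ : Form → Form → Form
  φ ⇒ ψ = ¬' (φ ∧' ¬' ψ)

  eval : (Form → Bool) → Form → Bool
  eval v (var p)  = v (var p)
  eval v (¬' φ)   = not (eval v φ)
  eval v (φ ∧' ψ) = eval v φ ∧ eval v ψ
  eval v (W φ)    = v (W φ)

  Tautology : Form → Set
  Tautology φ = ∀ (v : Form → Bool) → eval v φ ≡ true

  data _⊢_ (Ax : Pred Form 0ℓ) : Form → Set where
    A0  : ∀ {φ} → Tautology φ → Ax ⊢ φ
    A1  : ∀ {φ} → Ax ⊢ (W φ ⇒ ¬' φ)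
    A2  : ∀ {φ ψ} → Ax ⊢ ((W φ ∧' W ψ) ⇒ W (φ ∧' ψ))
    Ext : ∀ {φ} → Ax φ → Ax ⊢ φ
    MP  : ∀ {φ ψ} → Ax ⊢ φ → Ax ⊢ (φ ⇒ ψ) → Ax ⊢ ψ
    R1  : ∀ {φ ψ} → Ax ⊢ (φ ⇒ ψ) → Ax ⊢ ((W φ ∧' ¬' ψ) ⇒ W ψ)

  NoAx : Pred Form 0ℓ
  NoAx _ = ⊥

  TAx : Pred Form 0ℓ
  TAx χ = Σ Form (λ φ → χ ≡ ¬' (W φ))

  conj : Form → List Form → Form
  conj γ []       = γ
  conj γ (δ ∷ δs) = γ ∧' conj δ δs

  Consistent : Pred Form 0ℓ → Pred Form 0ℓ → Set
  Consistent Ax Γ = ∀ (γ : Form) (γs : List Form) → γ ∈ Γ → All (_∈ Γ) γs →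
                    ¬ (Ax ⊢ (¬' conj γ γs))

  record Frame (ℓ : Level) : Set (lsuc ℓ) where
    field
      S : Set ℓ
      R : S → S → Set ℓ

  record Model (ℓ : Level) : Set (lsuc ℓ) where
    field
      frame : Frame ℓ
    open Frame frame public
    field
      V : P → S → Set ℓ

  module _ {ℓ : Level} (M : Model ℓ) where
    open Model M
    _,_⊨_ : S → Form → Set ℓ
    _,_⊨_ s (var p)  = V p s
    _,_⊨_ s (¬' φ)   = ¬ (_,_⊨_ s φ)
    _,_⊨_ s (φ ∧' ψ) = _,_⊨_ s φ × _,_⊨_ s ψ
    _,_⊨_ s (W φ)    = ¬ (_,_⊨_ s φ) × (∀ t → R s t → _,_⊨_ t φ)

  Reflexive : ∀ {ℓ} → Frame ℓ → Set ℓ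
  Reflexive F = ∀ s → R s s where open Frame F

  FrameClass : Setω
  FrameClass = ∀ {ℓ} → Frame ℓ → Set ℓ

  Sound : Pred Form 0ℓ → FrameClass → Setω
  Sound Ax C = ∀ {ℓ} (M : Model ℓ) → C (Model.frame M) →
               ∀ φ → Ax ⊢ φ → ∀ s → _,_⊨_ M s φ

  StronglyComplete : Pred Form 0ℓ → FrameClass → Set₂
  StronglyComplete Ax C = ∀ (Γ : Pred Form 0ℓ) → Consistent Ax Γ →
    Σ (Model (lsuc 0ℓ)) (λ M → C (Model.frame M) ×
      Σ (Model.S M) (λ s → ∀ γ → γ ∈ Γ → _,_⊨_ M s γ))

  record SoundAndStronglyComplete (Ax : Pred Form 0ℓ) (C : FrameClass) : Setω where
    field
      sound            : Sound Ax C
      stronglyComplete : StronglyComplete Ax C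

-- In a reflexive frame W φ can never hold, since φ would have to be false
-- at the current state and true at all its successors, among them itself;
-- this is what the axiom ¬ W φ says, so soundness is routine.  Conversely,
-- a maximal consistent extension of a consistent set contains every ¬ W φ,
-- so it is satisfied at the single state of the one-point reflexive model
-- whose valuation is read off from the variables it contains.  Maximal
-- consistent sets are obtained from Zorn's lemma.

module Submission where

open import Defs
open import Axiom.ExcludedMiddle using (ExcludedMiddle)
open import Level using (Level; 0ℓ; Lift; lift; lower) renaming (suc to lsuc)
open import Data.Bool using (Bool; true; false; not; T)
open import Data.Bool.Properties using (T-∧; T-≡)
open import Data.Empty using (⊥-elim)
open import Data.Unit using (⊤; tt)
open import Data.Product using (Σ; _×_; _,_; proj₁; proj₂)
open import Data.Sum using (_⊎_; inj₁; inj₂)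
open import Data.List using (List; []; _∷_; _++_; foldr)
open import Data.List.Relation.Unary.All as All using (All; []; _∷_)
open import Data.List.Relation.Unary.All.Properties using (++⁺; ++⁻)
open import Function using (_∘_; const)
open import Function.Bundles using (_⇔_; mk⇔; Equivalence)
open import Relation.Nullary using (¬_; isYes)
open import Relation.Nullary.Decidable using (True; toWitness; fromWitness; decidable-stable; T?)
open import Relation.Unary using (Pred; _∈_; _∉_; _⊆_; _∪_; ｛_｝)
open import Relation.Binary.PropositionalEquality using (refl)

open Equivalence using (to; from)

T-not : ∀ {b} → T (not b) ⇔ (¬ T b)
T-not {true}  = mk⇔ (λ ()) (λ ¬t → ¬t tt)
T-not {false} = mk⇔ (λ _ ()) (const tt)

module _ {P : Set} where
  open Logic P

  infix 4 _⊩_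

  -- A record, so that v and φ can be inferred from the type.
  record _⊩_ (v : Form → Bool) (φ : Form) : Set where
    constructor holds
    field evaluatesTrue : T (eval v φ)
  open _⊩_

  ⊩-stable : ∀ {v φ} → ¬ ¬ v ⊩ φ → v ⊩ φ
  ⊩-stable {v} {φ} ¬¬φ = holds (decidable-stable (T? (eval v φ)) λ ¬t → ¬¬φ (¬t ∘ evaluatesTrue))

  ⊩-¬ : ∀ {v φ} → v ⊩ ¬' φ ⇔ (¬ v ⊩ φ)
  ⊩-¬ = mk⇔ (λ (holds t) (holds s) → to T-not t s)
            (λ ¬φ → holds (from T-not (¬φ ∘ holds)))

  ⊩-∧ : ∀ {v φ ψ} → v ⊩ φ ∧' ψ ⇔ (v ⊩ φ × v ⊩ ψ)
  ⊩-∧ = mk⇔ (λ (holds t) → let (s , u) = to T-∧ t in holds s , holds u)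
            (λ (holds s , holds u) → holds (from T-∧ (s , u)))

  ⊩-⇒ : ∀ {v φ ψ} → v ⊩ φ ⇒ ψ ⇔ (v ⊩ φ → v ⊩ ψ)
  ⊩-⇒ = mk⇔ (λ φ⇒ψ φ → ⊩-stable λ ¬ψ → to ⊩-¬ φ⇒ψ (from ⊩-∧ (φ , from ⊩-¬ ¬ψ)))
            (λ φ→ψ → from ⊩-¬ λ φ∧¬ψ →
               let (φ , ¬ψ) = to ⊩-∧ φ∧¬ψ in to ⊩-¬ ¬ψ (φ→ψ φ))

  module _ {Ax : Pred Form 0ℓ} where

    tautology : ∀ {φ} → (∀ v → v ⊩ φ) → Ax ⊢ φ
    tautology ⊩φ = A0 λ v → to T-≡ (evaluatesTrue (⊩φ v))

    tautological-consequence : ∀ {θ ψ} → Ax ⊢ θ → (∀ v → v ⊩ θ → v ⊩ ψ) → Ax ⊢ ψ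
    tautological-consequence ⊢θ θ⊨ψ = MP ⊢θ (tautology λ v → from ⊩-⇒ (θ⊨ψ v))

    tautological-consequence₂ : ∀ {θ₁ θ₂ ψ} → Ax ⊢ θ₁ → Ax ⊢ θ₂ →
                                (∀ v → v ⊩ θ₁ → v ⊩ θ₂ → v ⊩ ψ) → Ax ⊢ ψ
    tautological-consequence₂ ⊢θ₁ ⊢θ₂ θ₁θ₂⊨ψ =
      MP ⊢θ₂ (tautological-consequence ⊢θ₁ λ v ⊩θ₁ → from ⊩-⇒ (θ₁θ₂⊨ψ v ⊩θ₁))

  module _ {ℓ : Level} (M : Model ℓ) where
    open Model M

    reflexive⇒¬W : Reflexive frame → ∀ s φ → ¬ M , s ⊨ W φ
    reflexive⇒¬W refl-R s φ (¬φ , □φ) = ¬φ (□φ s (refl-R s))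

    module _ (lem : ExcludedMiddle ℓ) where

      ⊨-stable : ∀ {s φ} → ¬ ¬ M , s ⊨ φ → M , s ⊨ φ
      ⊨-stable = decidable-stable lem

      stateValuation : S → Form → Bool
      stateValuation s φ = isYes (lem {M , s ⊨ φ})

      stateValuation-⊩ : ∀ s φ → stateValuation s ⊩ φ ⇔ M , s ⊨ φ
      stateValuation-⊩ s (var p) = mk⇔ (toWitness ∘ evaluatesTrue) (holds ∘ fromWitness)
      stateValuation-⊩ s (W φ)   = mk⇔ (toWitness ∘ evaluatesTrue) (holds ∘ fromWitness)
      stateValuation-⊩ s (¬' φ)  =
        mk⇔ (λ ⊩¬φ ⊨φ → to ⊩-¬ ⊩¬φ (from (stateValuation-⊩ s φ) ⊨φ))
            (λ ⊭φ → from ⊩-¬ (⊭φ ∘ to (stateValuation-⊩ s φ)))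
      stateValuation-⊩ s (φ ∧' ψ) =
        mk⇔ (λ ⊩φ∧ψ → let (⊩φ , ⊩ψ) = to ⊩-∧ ⊩φ∧ψ in
                       to (stateValuation-⊩ s φ) ⊩φ , to (stateValuation-⊩ s ψ) ⊩ψ)
            (λ (⊨φ , ⊨ψ) →
               from ⊩-∧ (from (stateValuation-⊩ s φ) ⊨φ , from (stateValuation-⊩ s ψ) ⊨ψ))

      T-sound : Reflexive frame → ∀ {φ} → TAx ⊢ φ → ∀ s → M , s ⊨ φ
      T-sound _ {φ} (A0 taut) s =
        to (stateValuation-⊩ s φ) (holds (from T-≡ (taut (stateValuation s))))
      T-sound _ A1 s ((¬φ , _) , ¬¬φ) = ¬¬φ ¬φ
      T-sound _ A2 s (((¬φ , □φ) , (_ , □ψ)) , ¬W) =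
        ¬W ((λ (φ , _) → ¬φ φ) , λ t sRt → □φ t sRt , □ψ t sRt)
      T-sound refl-R (Ext (φ , refl)) s = reflexive⇒¬W refl-R s φ
      T-sound refl-R {ψ} (MP ⊢φ ⊢φ⇒ψ) s =
        ⊨-stable {s} {ψ} λ ¬ψ → T-sound refl-R ⊢φ⇒ψ s (T-sound refl-R ⊢φ s , ¬ψ)
      T-sound refl-R (R1 {ψ = ψ} ⊢φ⇒ψ) s (((_ , □φ) , ¬ψ) , ¬W) =
        ¬W (¬ψ , λ t sRt → ⊨-stable {t} {ψ} λ ¬ψt → T-sound refl-R ⊢φ⇒ψ t (□φ t sRt , ¬ψt))

  T-soundness : (∀ {ℓ} → ExcludedMiddle ℓ) → Sound TAx Reflexive
  T-soundness lem M refl-R φ ⊢φ s = T-sound M lem refl-R ⊢φ s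

  pointModel : ∀ {ℓ} → (P → Set ℓ) → Model ℓ
  pointModel {ℓ} V = record
    { frame = record { S = Lift ℓ ⊤ ; R = λ _ _ → Lift ℓ ⊤ }
    ; V     = λ p _ → V p }

  pointModel-reflexive : ∀ {ℓ} (V : P → Set ℓ) → Reflexive (Model.frame (pointModel V))
  pointModel-reflexive V _ = lift tt

  module _ (p₀ : P) where

    -- Forming a formula needs a variable; this is why P must be inhabited.
    ⊤ᶠ : Form
    ⊤ᶠ = var p₀ ⇒ var p₀

    ⋀ : List Form → Form
    ⋀ = foldr _∧'_ ⊤ᶠ

    ⊩-⋀ : ∀ {v} Φ → v ⊩ ⋀ Φ ⇔ All (v ⊩_) Φ
    ⊩-⋀ []      = mk⇔ (const []) (const (from ⊩-⇒ λ p → p))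
    ⊩-⋀ (φ ∷ Φ) = mk⇔ (λ ⊩φΦ → let (⊩φ , ⊩Φ) = to ⊩-∧ ⊩φΦ in ⊩φ ∷ to (⊩-⋀ Φ) ⊩Φ)
                      λ { (⊩φ ∷ ⊩Φ) → from ⊩-∧ (⊩φ , from (⊩-⋀ Φ) ⊩Φ) }

    T⊬¬⊤ : (∀ {ℓ} → ExcludedMiddle ℓ) → ¬ TAx ⊢ (¬' ⊤ᶠ)
    T⊬¬⊤ lem ⊢¬⊤ =
      T-soundness lem (pointModel V⊤) (pointModel-reflexive V⊤) _ ⊢¬⊤ (lift tt) λ (p , ¬p) → ¬p p
      where
        V⊤ : P → Set
        V⊤ _ = ⊤

    module _ (Ax : Pred Form 0ℓ) where

      -- Lists may be empty, so that a formula refuted by a theorem alone is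
      -- also inconsistent with the set.
      ListConsistent : Pred Form 0ℓ → Set
      ListConsistent Δ = ∀ Φ → All (_∈ Δ) Φ → ¬ Ax ⊢ (¬' ⋀ Φ)

      consistent⇒listConsistent : ¬ Ax ⊢ (¬' ⊤ᶠ) → ∀ {Γ} → Consistent Ax Γ → ListConsistent Γ
      consistent⇒listConsistent ⊬¬⊤ Γ-cons []      _           = ⊬¬⊤
      consistent⇒listConsistent ⊬¬⊤ Γ-cons (γ ∷ Φ) (γ∈Γ ∷ Φ⊆Γ) ⊢¬⋀ =
        Γ-cons γ Φ γ∈Γ Φ⊆Γ (tautological-consequence ⊢¬⋀ λ v ⊩¬⋀ →
          from ⊩-¬ λ ⊩conj → to ⊩-¬ ⊩¬⋀ (from (⊩-⋀ (γ ∷ Φ)) (conj-⊩ γ Φ ⊩conj)))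
        where
          conj-⊩ : ∀ {v} γ Φ → v ⊩ conj γ Φ → All (v ⊩_) (γ ∷ Φ)
          conj-⊩ γ []      ⊩γ    = ⊩γ ∷ []
          conj-⊩ γ (δ ∷ Φ) ⊩γ∧Φ = let (⊩γ , ⊩Φ) = to ⊩-∧ ⊩γ∧Φ in ⊩γ ∷ conj-⊩ δ Φ ⊩Φ

      record MaximalConsistent (Δ : Pred Form 0ℓ) : Set₁ where
        field
          consistent : ListConsistent Δ
          maximal    : ∀ ψ → ListConsistent (Δ ∪ ｛ ψ ｝) → ψ ∈ Δ

      module _ (lem : ExcludedMiddle (lsuc 0ℓ)) {Γ : Pred Form 0ℓ} (Γ-cons : ListConsistent Γ) where

        Extension : Set₁
        Extension = Σ (Pred Form 0ℓ) λ Δ → ListConsistent Δ × Γ ⊆ Δ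

        _≤_ : Extension → Extension → Set₁
        (Δ , _) ≤ (Δ′ , _) = Lift _ (Δ ⊆ Δ′)

        ≤-refl : ∀ x → x ≤ x
        ≤-refl _ = lift λ φ∈ → φ∈

        ≤-trans : ∀ x y z → x ≤ y → y ≤ z → x ≤ z
        ≤-trans _ _ _ (lift x⊆y) (lift y⊆z) = lift (y⊆z ∘ x⊆y)

        module _ (C : Pred Extension (lsuc 0ℓ))
                 (comparable : ∀ x y → C x → C y → x ≤ y ⊎ y ≤ x) where

          InMember : List Form → Set₁
          InMember Φ = Σ Extension λ x → C x × All (_∈ proj₁ x) Φ

          -- Excluded middle squashes the large statement "φ lies in a member
          -- of C" into a small one, making the union a predicate in Set; Γ is
          -- included so that the empty chain is bounded too.
          ⋃C : Pred Form 0ℓ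
          ⋃C φ = φ ∈ Γ ⊎ True (lem {Σ Extension λ x → C x × φ ∈ proj₁ x})

          ⋃C-finite-∷ : ∀ {φ Φ} → φ ∈ ⋃C → All (_∈ Γ) Φ ⊎ InMember Φ →
                        All (_∈ Γ) (φ ∷ Φ) ⊎ InMember (φ ∷ Φ)
          ⋃C-finite-∷ (inj₁ φ∈Γ) (inj₁ Φ⊆Γ)             = inj₁ (φ∈Γ ∷ Φ⊆Γ)
          ⋃C-finite-∷ (inj₁ φ∈Γ) (inj₂ (x , Cx , Φ⊆x)) = inj₂ (x , Cx , proj₂ (proj₂ x) φ∈Γ ∷ Φ⊆x)
          ⋃C-finite-∷ (inj₂ φ∈C) (inj₁ Φ⊆Γ) =
            let (y , Cy , φ∈y) = toWitness φ∈C
            in inj₂ (y , Cy , φ∈y ∷ All.map (proj₂ (proj₂ y)) Φ⊆Γ)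
          ⋃C-finite-∷ (inj₂ φ∈C) (inj₂ (z , Cz , Φ⊆z)) with toWitness φ∈C
          ... | y , Cy , φ∈y with comparable y z Cy Cz
          ...   | inj₁ (lift y⊆z) = inj₂ (z , Cz , y⊆z φ∈y ∷ Φ⊆z)
          ...   | inj₂ (lift z⊆y) = inj₂ (y , Cy , φ∈y ∷ All.map z⊆y Φ⊆z)

          ⋃C-finite : ∀ {Φ} → All (_∈ ⋃C) Φ → All (_∈ Γ) Φ ⊎ InMember Φ
          ⋃C-finite []           = inj₁ []
          ⋃C-finite (φ∈ ∷ Φ⊆⋃C) = ⋃C-finite-∷ φ∈ (⋃C-finite Φ⊆⋃C)

          ⋃C-consistent : ListConsistent ⋃C
          ⋃C-consistent Φ Φ⊆⋃C with ⋃C-finite Φ⊆⋃C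
          ... | inj₁ Φ⊆Γ                          = Γ-cons Φ Φ⊆Γ
          ... | inj₂ ((_ , x-cons , _) , _ , Φ⊆x) = x-cons Φ Φ⊆x

          chain-bound : Σ Extension λ u → ∀ x → C x → x ≤ u
          chain-bound = (⋃C , ⋃C-consistent , inj₁) ,
                        λ x Cx → lift λ φ∈x → inj₂ (fromWitness (x , Cx , φ∈x))

        lindenbaum : Zorn (lsuc 0ℓ) → Σ (Pred Form 0ℓ) λ Δ → Γ ⊆ Δ × MaximalConsistent Δ
        lindenbaum zorn with zorn Extension _≤_ ≤-refl ≤-trans chain-bound
        ... | (Δ , Δ-cons , Γ⊆Δ) , Δ-greatest = Δ , Γ⊆Δ , record
          { consistent = Δ-cons
          ; maximal    = λ ψ Δψ-cons →
              lower (Δ-greatest (Δ ∪ ｛ ψ ｝ , Δψ-cons , inj₁ ∘ Γ⊆Δ) (lift inj₁)) (inj₂ refl) }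

      split-added : ∀ {Δ : Pred Form 0ℓ} {ψ} Φ → All (_∈ Δ ∪ ｛ ψ ｝) Φ →
                    Σ (List Form) λ Φ′ → All (_∈ Δ) Φ′ ×
                      (∀ v → All (v ⊩_) Φ′ → v ⊩ ψ → All (v ⊩_) Φ)
      split-added [] [] = [] , [] , λ _ _ _ → []
      split-added (φ ∷ Φ) (inj₁ φ∈Δ ∷ Φ⊆) =
        let (Φ′ , Φ′⊆Δ , restore) = split-added Φ Φ⊆
        in φ ∷ Φ′ , φ∈Δ ∷ Φ′⊆Δ , λ { v (⊩φ ∷ ⊩Φ′) ⊩ψ → ⊩φ ∷ restore v ⊩Φ′ ⊩ψ }
      split-added (φ ∷ Φ) (inj₂ refl ∷ Φ⊆) =
        let (Φ′ , Φ′⊆Δ , restore) = split-added Φ Φ⊆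
        in Φ′ , Φ′⊆Δ , λ v ⊩Φ′ ⊩ψ → ⊩ψ ∷ restore v ⊩Φ′ ⊩ψ

      module MaximalConsistentSet {Δ} (mc : MaximalConsistent Δ) where
        open MaximalConsistent mc

        ∈-if-unrefuted : ∀ ψ → (∀ Φ → All (_∈ Δ) Φ → ¬ Ax ⊢ (¬' (⋀ Φ ∧' ψ))) → ψ ∈ Δ
        ∈-if-unrefuted ψ unrefuted = maximal ψ λ Φ Φ⊆ ⊢¬⋀Φ →
          let (Φ′ , Φ′⊆Δ , restore) = split-added Φ Φ⊆
          in unrefuted Φ′ Φ′⊆Δ (tautological-consequence ⊢¬⋀Φ λ v ⊩¬⋀Φ →
               from ⊩-¬ λ ⊩Φ′∧ψ → let (⊩⋀Φ′ , ⊩ψ) = to ⊩-∧ ⊩Φ′∧ψ in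
                 to ⊩-¬ ⊩¬⋀Φ (from (⊩-⋀ Φ) (restore v (to (⊩-⋀ Φ′) ⊩⋀Φ′) ⊩ψ)))

        deductively-closed : ∀ {Φ ψ} → All (_∈ Δ) Φ → Ax ⊢ (⋀ Φ ⇒ ψ) → ψ ∈ Δ
        deductively-closed {Φ} {ψ} Φ⊆Δ ⊢Φ⇒ψ = ∈-if-unrefuted ψ λ Φ′ Φ′⊆Δ ⊢¬Φ′∧ψ →
          consistent (Φ ++ Φ′) (++⁺ Φ⊆Δ Φ′⊆Δ)
            (tautological-consequence₂ ⊢Φ⇒ψ ⊢¬Φ′∧ψ λ v ⊩Φ⇒ψ ⊩¬Φ′∧ψ →
              from ⊩-¬ λ ⊩ΦΦ′ → let (⊩Φ , ⊩Φ′) = ++⁻ Φ (to (⊩-⋀ (Φ ++ Φ′)) ⊩ΦΦ′) in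
                to ⊩-¬ ⊩¬Φ′∧ψ (from ⊩-∧ (from (⊩-⋀ Φ′) ⊩Φ′ , to ⊩-⇒ ⊩Φ⇒ψ (from (⊩-⋀ Φ) ⊩Φ))))

        tautologically-closed : ∀ {Φ ψ} → All (_∈ Δ) Φ → (∀ v → All (v ⊩_) Φ → v ⊩ ψ) → ψ ∈ Δ
        tautologically-closed {Φ} Φ⊆Δ Φ⊨ψ =
          deductively-closed Φ⊆Δ (tautology λ v → from ⊩-⇒ (Φ⊨ψ v ∘ to (⊩-⋀ Φ)))

        theorem-∈ : ∀ {ψ} → Ax ⊢ ψ → ψ ∈ Δ
        theorem-∈ ⊢ψ = deductively-closed []
          (tautological-consequence ⊢ψ λ _ ⊩ψ → from ⊩-⇒ (const ⊩ψ))

        ¬'∈⇔∉ : ∀ {φ} → ¬' φ ∈ Δ ⇔ φ ∉ Δ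
        ¬'∈⇔∉ {φ} = mk⇔
          (λ ¬φ∈Δ φ∈Δ → consistent (φ ∷ ¬' φ ∷ []) (φ∈Δ ∷ ¬φ∈Δ ∷ [])
            (tautology λ v → from ⊩-¬ λ ⊩⋀ →
              let (⊩φ , ⊩¬φ∧⊤) = to ⊩-∧ ⊩⋀ in to ⊩-¬ (proj₁ (to ⊩-∧ ⊩¬φ∧⊤)) ⊩φ))
          (λ φ∉Δ → ∈-if-unrefuted (¬' φ) λ Φ Φ⊆Δ ⊢¬Φ∧¬φ →
            φ∉Δ (deductively-closed Φ⊆Δ (tautological-consequence ⊢¬Φ∧¬φ
              λ v ⊩¬Φ∧¬φ → from ⊩-⇒ λ ⊩Φ → ⊩-stable λ ⊮φ →
                to ⊩-¬ ⊩¬Φ∧¬φ (from ⊩-∧ (⊩Φ , from ⊩-¬ ⊮φ)))))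

        ∧'∈⇔ : ∀ {φ ψ} → φ ∧' ψ ∈ Δ ⇔ (φ ∈ Δ × ψ ∈ Δ)
        ∧'∈⇔ = mk⇔
          (λ φψ∈Δ → tautologically-closed (φψ∈Δ ∷ []) (λ { v (⊩φψ ∷ []) → proj₁ (to ⊩-∧ ⊩φψ) })
                  , tautologically-closed (φψ∈Δ ∷ []) (λ { v (⊩φψ ∷ []) → proj₂ (to ⊩-∧ ⊩φψ) }))
          (λ (φ∈Δ , ψ∈Δ) → tautologically-closed (φ∈Δ ∷ ψ∈Δ ∷ [])
             λ { v (⊩φ ∷ ⊩ψ ∷ []) → from ⊩-∧ (⊩φ , ⊩ψ) })

    module _ {Δ : Pred Form 0ℓ} (mc : MaximalConsistent TAx Δ) where
      open MaximalConsistentSet TAx mc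

      canonicalValuation : P → Set₁
      canonicalValuation p = Lift _ (var p ∈ Δ)

      canonicalModel : Model (lsuc 0ℓ)
      canonicalModel = pointModel canonicalValuation

      canonicalModel-reflexive : Reflexive (Model.frame canonicalModel)
      canonicalModel-reflexive = pointModel-reflexive canonicalValuation

      canonical-truth : ∀ φ → canonicalModel , lift tt ⊨ φ ⇔ φ ∈ Δ
      canonical-truth (var p)  = mk⇔ lower lift
      canonical-truth (¬' φ)   =
        mk⇔ (λ ⊭φ → from ¬'∈⇔∉ (⊭φ ∘ from (canonical-truth φ)))
            (λ ¬φ∈Δ → to ¬'∈⇔∉ ¬φ∈Δ ∘ to (canonical-truth φ))
      canonical-truth (φ ∧' ψ) =
        mk⇔ (λ (⊨φ , ⊨ψ) → from ∧'∈⇔ (to (canonical-truth φ) ⊨φ , to (canonical-truth ψ) ⊨ψ))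
            (λ φψ∈Δ → let (φ∈Δ , ψ∈Δ) = to ∧'∈⇔ φψ∈Δ in
                      from (canonical-truth φ) φ∈Δ , from (canonical-truth ψ) ψ∈Δ)
      canonical-truth (W φ)    =
        mk⇔ (⊥-elim ∘ reflexive⇒¬W canonicalModel canonicalModel-reflexive (lift tt) φ)
            (⊥-elim ∘ to ¬'∈⇔∉ (theorem-∈ (Ext (φ , refl))))

    T-stronglyComplete : (∀ {ℓ} → ExcludedMiddle ℓ) → Zorn (lsuc 0ℓ) →
                         StronglyComplete TAx Reflexive
    T-stronglyComplete lem zorn Γ Γ-cons =
      let (Δ , Γ⊆Δ , mc) = lindenbaum TAx lem
                             (consistent⇒listConsistent TAx (T⊬¬⊤ lem) Γ-cons) zorn
      in canonicalModel mc , canonicalModel-reflexive mc , lift tt ,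
         λ γ γ∈Γ → from (canonical-truth mc γ) (Γ⊆Δ γ∈Γ)

mainTheorem5 : (lem : ∀ {ℓ} → ExcludedMiddle ℓ) → (zorn : ∀ {ℓ} → Zorn ℓ) →
    (P : Set) → P →
    Logic.SoundAndStronglyComplete P (Logic.TAx P) (Logic.Reflexive P)
mainTheorem5 lem zorn P p₀ = record
  { sound            = T-soundness {P} lem
  ; stronglyComplete = T-stronglyComplete {P} p₀ lem zorn }
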